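{- Let $n\ge 1$ and let $\mathsf{AP}_L$, $\mathsf{AP}^O$ be finite sets, $\mathcal{I}=2^{\mathsf{AP}_L\times\{0,\dots,n-1\}}$, $\mathcal{O}=2^{\mathsf{AP}^O\times\{0,\dots,n-1\}}$. A computation tree $\langle \mathcal{I}^*,\tau\rangle$ with $\tau:\mathcal{I}^*\to\mathcal{O}$ is regular and has the symmetry property if and only if there exists a (finite-state) Moore machine $\mathcal{M}$ with input alphabet $\mathcal{I}$ and output alphabet $2^{\mathsf{AP}^O}$ such that $\langle \mathcal{I}^*,\tau\rangle$ is the computation tree induced by the symmetric product of $\mathcal{M}$ (i.e., the tree induced by plugging $\mathcal{M}$ as the process implementation into the $n$-process rotation-symmetric architecture).
   Context: $x \bmod n$ always denotes the representative in $\{0,\dots,n-1\}$. For a set $\mathsf{AP}$, $u\subseteq \mathsf{AP}\times\{0,\dots,n-1\}$ and $k\in\mathbb{Z}$, the rotation is $\mathrm{rot}(u,k)=\{(p,(j+k)\bmod n)\mid (p,j)\in u\}$; it is extended to finite words letterwise. A computation tree is a pair $\langle T,\tau\rangle$ with $T=\mathcal{I}^*$ and $\tau:T\to\mathcal{O}$ ($\tau(t)$ is the output after having read input sequence $t$). For $\hat t\in T$, the subtree at $\hat t$ is the tree $t\mapsto \tau(\hat t t)$; the tree is regular if it has only finitely many distinct subtrees. The tree has the symmetry property if for every $t\in T$ and $0\le i<n$, $\tau(\mathrm{rot}(t,i))=\mathrm{rot}(\tau(t),i)$. A Moore machine $\mathcal{M}=(S,\mathcal{I},O,\delta,s_0,L)$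 has a finite state set $S$, transition function $\delta:S\times\mathcal{I}\to S$, initial state $s_0$ and labelling $L:S\to O$; it induces the tree $\tau(t)=L(\delta^*(s_0,t))$ where $\delta^*$ is the extension of $\delta$ to words. For $\mathcal{M}$ with $O=2^{\mathsf{AP}^O}$, its symmetric product is the Moore machine with state set $S^n$, initial state $(s_0,\dots,s_0)$, transition $\delta'((s_0',\dots,s_{n-1}'),\iota)=(s_0'',\dots,s_{n-1}'')$ with $s_j''=\delta(s_j',\mathrm{rot}(\iota,-j))$ for all $0\le j<n$, and labelling $L'(s_0',\dots,s_{n-1}')=\bigcup_{j}L(s_j')\times\{j\}\in\mathcal{O}$. (Process $j$ thus sees the global input rotated by $-j$ and writes its outputs to the propositions indexed $j$.) -}

module Defs where

open import Data.Nat as ℕ using (ℕ; NonZero)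
open import Data.Integer as ℤ using (ℤ; +_; _-_)
open import Data.Integer.DivMod using (_%ℕ_; n%ℕd<d)
open import Data.Fin using (Fin; toℕ; fromℕ<)
open import Data.Bool using (Bool)
open import Data.Vec using (Vec; tabulate; lookup; map)
open import Data.List as List using (List; _++_)
open import Data.Product using (Σ; ∃; _×_; _,_)
open import Data.List.Membership.Propositional using (_∈_)
open import Relation.Binary.PropositionalEquality using (_≡_)

-- Atomic propositions: AP_L = Fin a, AP^O = Fin b (arbitrary finite sets).
-- A subset u ⊆ AP × {0,…,n-1} is represented by its characteristic table:
-- for each proposition p a vector of n bits (bit j  ⇔  (p , j) ∈ u).
Subset2 : ℕ → ℕ → Set
Subset2 m n = Vec (Vec Bool n) m

Inp : ℕ → ℕ → Set
Inp a n = Subset2 a n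

Out : ℕ → ℕ → Set
Out b n = Subset2 b n

shiftIdx : ∀ {n} .{{_ : NonZero n}} → ℤ → Fin n → Fin n
shiftIdx {n} k i = fromℕ< (n%ℕd<d ((+ toℕ i) - k) n)

-- rot(u,k) = {(p,(j+k) mod n) | (p,j) ∈ u}:
-- (p , i) ∈ rot(u,k)  ⇔  (p , (i - k) mod n) ∈ u.
rot : ∀ {m n} .{{_ : NonZero n}} → Subset2 m n → ℤ → Subset2 m n
rot u k = map (λ row → tabulate (λ i → lookup row (shiftIdx k i))) u

rotWord : ∀ {m n} .{{_ : NonZero n}} → List (Subset2 m n) → ℤ → List (Subset2 m n)
rotWord t k = List.map (λ u → rot u k) t

Tree : ℕ → ℕ → ℕ → Set
Tree a b n = List (Inp a n) → Out b n

subtree : ∀ {a b n} → Tree a b n → List (Inp a n) → Tree a b n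
subtree τ t̂ = λ t → τ (t̂ ++ t)

_≗T_ : ∀ {a b n} → Tree a b n → Tree a b n → Set
τ ≗T σ = ∀ t → τ t ≡ σ t

-- regular: only finitely many distinct subtrees, i.e. there is a finite list
-- of positions such that every subtree equals the subtree at one of them.
Regular : ∀ {a b n} → Tree a b n → Set
Regular {a} {b} {n} τ =
  Σ (List (List (Inp a n))) λ reps →
    ∀ t → ∃ λ r → (r ∈ reps) × (subtree τ t ≗T subtree τ r)

Symmetric : ∀ {a b n} .{{_ : NonZero n}} → Tree a b n → Set
Symmetric {n = n} τ = ∀ t (i : Fin n) → τ (rotWord t (+ toℕ i)) ≡ rot (τ t) (+ toℕ i)

record Moore (I O : Set) : Set₁ where
  field
    k  : ℕ
    δ  : Fin k → I → Fin k
    s₀ : Fin k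
    L  : Fin k → O

run : ∀ {S I : Set} → (S → I → S) → S → List I → S
run δ s List.[] = s
run δ s (ι List.∷ t) = run δ (δ s ι) t

-- The computation tree induced by the symmetric product of a machine M with
-- input alphabet 𝓘 and output alphabet 2^{AP^O} (= Vec Bool b).
-- States of the product: S^n, represented as Fin n → S.
module _ {a b n : ℕ} .{{_ : NonZero n}} (M : Moore (Inp a n) (Vec Bool b)) where
  open Moore M

  prodδ : (Fin n → Fin k) → Inp a n → (Fin n → Fin k)
  prodδ s ι j = δ (s j) (rot ι (ℤ.- (+ toℕ j)))

  prodS₀ : Fin n → Fin k
  prodS₀ _ = s₀

  prodL : (Fin n → Fin k) → Out b n
  prodL s = tabulate (λ p → tabulate (λ j → lookup (L (s j)) p))

  symProdTree : Tree a b n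
  symProdTree t = prodL (run prodδ prodS₀ t)

module Submission where

-- Process j of a symmetric product reads the input rotated by -j; rotating the
-- global input by k therefore permutes the processes, so product trees are
-- symmetric.  They are also regular: a tree that factors through a right
-- congruence with finitely many classes (here the product state, encoded by
-- funToFin) is regular, since by pigeonhole every word is equivalent to one of
-- length at most the number of classes.  Conversely a regular tree is induced by
-- its Nerode machine, whose states are the representative subtrees; keeping only
-- the outputs of process 0 yields a machine whose symmetric product recomputes a
-- symmetric tree.

open import Defs
open import Data.Nat as ℕ using (ℕ; zero; suc; NonZero; _≤_; _<_; _∸_; _⊓_; _^_; _≤?_)
import Data.Nat.Properties as ℕP
open import Data.Nat.DivMod using (m<n⇒m%n≡m)
open import Data.Nat.Divisibility using (_∣_; n∣m*n; ∣⇒≤)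
open import Data.Integer as ℤ using (ℤ; +_; _⊖_)
open import Data.Integer.DivMod using (_%ℕ_; _/ℕ_; n%ℕd<d; a≡a%ℕn+[a/ℕn]*n)
import Data.Integer.Properties as ℤP
open import Data.Integer.Properties using ([+m]-[+n]≡m⊖n)
open import Data.Integer.Tactic.RingSolver using (solve-∀)
open import Data.Fin as F using (Fin; toℕ; fromℕ<; funToFin; finToFun; combine)
open import Data.Fin.Properties using (toℕ-fromℕ<; toℕ-injective; toℕ<n; pigeonhole; finToFun-funToFin)
open import Data.Bool using (Bool; true; false)
open import Data.Vec as V using (Vec; tabulate; lookup)
open import Data.Vec.Properties using (lookup-map; lookup∘tabulate; tabulate-cong)
open import Data.Vec.Relation.Binary.Pointwise.Extensional using (ext; Pointwise-≡⇒≡)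
open import Data.List as List using (List; []; _∷_; _++_; take; drop; length; cartesianProductWith)
import Data.List.Properties as LP
open import Data.List.Relation.Unary.Any as Any using (here; there)
open import Data.List.Relation.Unary.Any.Properties using (lookup-index)
open import Data.List.Membership.Propositional using (_∈_)
open import Data.List.Membership.Propositional.Properties using (∈-cartesianProductWith⁺)
open import Data.Product using (Σ; ∃; _×_; _,_; proj₁; proj₂)
open import Data.Empty using (⊥-elim)
open import Relation.Nullary using (yes; no)
open import Relation.Binary.PropositionalEquality
open import Function.Bundles using (_⇔_; mk⇔)

infix 4 _≡_mod_
_≡_mod_ : ℤ → ℤ → (n : ℕ) .{{_ : NonZero n}} → Set
_≡_mod_ x y n = x %ℕ n ≡ y %ℕ n

multiple-below⇒0 : ∀ {m n} → n ∣ m → m < n → m ≡ 0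
multiple-below⇒0 {zero} _ _ = refl
multiple-below⇒0 {suc m} n∣m m<n = ⊥-elim (ℕP.<⇒≱ m<n (∣⇒≤ n∣m))

residue-unique : ∀ {n r r'} (q q' : ℤ) → r < n → r' < n →
  + r ℤ.+ q ℤ.* + n ≡ + r' ℤ.+ q' ℤ.* + n → r ≡ r'
residue-unique {n} {r} {r'} q q' r<n r'<n eq =
  ℤP.+-injective (ℤP.i-j≡0⇒i≡j (+ r) (+ r') (trans ([+m]-[+n]≡m⊖n r r') (ℤP.∣i∣≡0⇒i≡0 ∣r⊖r'∣≡0)))
  where
  open ≡-Reasoning
  difference : + r ℤ.- + r' ≡ (q' ℤ.- q) ℤ.* + n
  difference = begin
    + r ℤ.- + r'                                                    ≡⟨ regroup (+ r) (+ r') q q' (+ n) ⟩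
    ((+ r ℤ.+ q ℤ.* + n) ℤ.- (+ r' ℤ.+ q' ℤ.* + n)) ℤ.+ (q' ℤ.- q) ℤ.* + n
      ≡⟨ cong (λ v → (v ℤ.- (+ r' ℤ.+ q' ℤ.* + n)) ℤ.+ (q' ℤ.- q) ℤ.* + n) eq ⟩
    ((+ r' ℤ.+ q' ℤ.* + n) ℤ.- (+ r' ℤ.+ q' ℤ.* + n)) ℤ.+ (q' ℤ.- q) ℤ.* + n
      ≡⟨ cancel (+ r' ℤ.+ q' ℤ.* + n) ((q' ℤ.- q) ℤ.* + n) ⟩
    (q' ℤ.- q) ℤ.* + n                                              ∎
    where
    regroup : ∀ x y q q' n → x ℤ.- y ≡ ((x ℤ.+ q ℤ.* n) ℤ.- (y ℤ.+ q' ℤ.* n)) ℤ.+ (q' ℤ.- q) ℤ.* n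
    regroup = solve-∀
    cancel : ∀ x y → (x ℤ.- x) ℤ.+ y ≡ y
    cancel = solve-∀
  n∣∣r⊖r'∣ : n ∣ ℤ.∣ r ⊖ r' ∣
  n∣∣r⊖r'∣ = subst (n ∣_) (begin
    ℤ.∣ q' ℤ.- q ∣ ℕ.* n      ≡⟨ sym (ℤP.abs-* (q' ℤ.- q) (+ n)) ⟩
    ℤ.∣ (q' ℤ.- q) ℤ.* + n ∣  ≡⟨ cong ℤ.∣_∣ (sym difference) ⟩
    ℤ.∣ + r ℤ.- + r' ∣        ≡⟨ cong ℤ.∣_∣ ([+m]-[+n]≡m⊖n r r') ⟩
    ℤ.∣ r ⊖ r' ∣              ∎) (n∣m*n ℤ.∣ q' ℤ.- q ∣)
  ∣r⊖r'∣≡0 : ℤ.∣ r ⊖ r' ∣ ≡ 0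
  ∣r⊖r'∣≡0 = multiple-below⇒0 n∣∣r⊖r'∣ (ℕP.≤-<-trans (ℤP.∣m⊝n∣≤m⊔n r r') (ℕP.⊔-lub r<n r'<n))

module _ (n : ℕ) .{{_ : NonZero n}} where

  mod⇒multiple : ∀ x y → x ≡ y mod n → y ≡ x ℤ.+ (y /ℕ n ℤ.- x /ℕ n) ℤ.* + n
  mod⇒multiple x y x≡y = begin
    y                                                ≡⟨ a≡a%ℕn+[a/ℕn]*n y n ⟩
    + (y %ℕ n) ℤ.+ y /ℕ n ℤ.* + n                    ≡⟨ cong (λ r → + r ℤ.+ y /ℕ n ℤ.* + n) (sym x≡y) ⟩
    + (x %ℕ n) ℤ.+ y /ℕ n ℤ.* + n                    ≡⟨ regroup (+ (x %ℕ n)) (x /ℕ n) (y /ℕ n) (+ n) ⟩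
    (+ (x %ℕ n) ℤ.+ x /ℕ n ℤ.* + n) ℤ.+ (y /ℕ n ℤ.- x /ℕ n) ℤ.* + n
      ≡⟨ cong (ℤ._+ (y /ℕ n ℤ.- x /ℕ n) ℤ.* + n) (sym (a≡a%ℕn+[a/ℕn]*n x n)) ⟩
    x ℤ.+ (y /ℕ n ℤ.- x /ℕ n) ℤ.* + n                ∎
    where
    open ≡-Reasoning
    regroup : ∀ r q q' n → r ℤ.+ q' ℤ.* n ≡ (r ℤ.+ q ℤ.* n) ℤ.+ (q' ℤ.- q) ℤ.* n
    regroup = solve-∀

  multiple⇒mod : ∀ x y q → y ≡ x ℤ.+ q ℤ.* + n → x ≡ y mod n
  multiple⇒mod x y q refl =
    residue-unique (x /ℕ n) (y /ℕ n ℤ.- q) (n%ℕd<d x n) (n%ℕd<d y n) (begin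
      + (x %ℕ n) ℤ.+ x /ℕ n ℤ.* + n               ≡⟨ sym (a≡a%ℕn+[a/ℕn]*n x n) ⟩
      x                                            ≡⟨ unshift x q (+ n) ⟩
      y ℤ.- q ℤ.* + n                              ≡⟨ cong (ℤ._- q ℤ.* + n) (a≡a%ℕn+[a/ℕn]*n y n) ⟩
      (+ (y %ℕ n) ℤ.+ y /ℕ n ℤ.* + n) ℤ.- q ℤ.* + n ≡⟨ regroup (+ (y %ℕ n)) (y /ℕ n) q (+ n) ⟩
      + (y %ℕ n) ℤ.+ (y /ℕ n ℤ.- q) ℤ.* + n        ∎)
    where
    open ≡-Reasoning
    unshift : ∀ x q n → x ≡ (x ℤ.+ q ℤ.* n) ℤ.- q ℤ.* n
    unshift = solve-∀
    regroup : ∀ r p q n → (r ℤ.+ p ℤ.* n) ℤ.- q ℤ.* n ≡ r ℤ.+ (p ℤ.- q) ℤ.* n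
    regroup = solve-∀

  residue-mod : ∀ x → + (x %ℕ n) ≡ x mod n
  residue-mod x = multiple⇒mod (+ (x %ℕ n)) x (x /ℕ n) (a≡a%ℕn+[a/ℕn]*n x n)

  +-congˡ-mod : ∀ x x' y → x ≡ x' mod n → x ℤ.+ y ≡ x' ℤ.+ y mod n
  +-congˡ-mod x x' y x≡x' = multiple⇒mod (x ℤ.+ y) (x' ℤ.+ y) q (begin
    x' ℤ.+ y                  ≡⟨ cong (ℤ._+ y) (mod⇒multiple x x' x≡x') ⟩
    (x ℤ.+ q ℤ.* + n) ℤ.+ y   ≡⟨ swap x (q ℤ.* + n) y ⟩
    (x ℤ.+ y) ℤ.+ q ℤ.* + n   ∎)
    where
    open ≡-Reasoning
    q = x' /ℕ n ℤ.- x /ℕ n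
    swap : ∀ x a y → (x ℤ.+ a) ℤ.+ y ≡ (x ℤ.+ y) ℤ.+ a
    swap = solve-∀

  +-congʳ-mod : ∀ x x' y → x ≡ x' mod n → y ℤ.+ x ≡ y ℤ.+ x' mod n
  +-congʳ-mod x x' y x≡x' = begin
    (y ℤ.+ x) %ℕ n   ≡⟨ cong (_%ℕ n) (ℤP.+-comm y x) ⟩
    (x ℤ.+ y) %ℕ n   ≡⟨ +-congˡ-mod x x' y x≡x' ⟩
    (x' ℤ.+ y) %ℕ n  ≡⟨ cong (_%ℕ n) (ℤP.+-comm x' y) ⟩
    (y ℤ.+ x') %ℕ n  ∎
    where open ≡-Reasoning

  neg-cong-mod : ∀ x x' → x ≡ x' mod n → ℤ.- x ≡ ℤ.- x' mod n
  neg-cong-mod x x' x≡x' = multiple⇒mod (ℤ.- x) (ℤ.- x') (ℤ.- q) (begin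
    ℤ.- x'                         ≡⟨ cong ℤ.-_ (mod⇒multiple x x' x≡x') ⟩
    ℤ.- (x ℤ.+ q ℤ.* + n)          ≡⟨ distrib x q (+ n) ⟩
    ℤ.- x ℤ.+ (ℤ.- q) ℤ.* + n      ∎)
    where
    open ≡-Reasoning
    q = x' /ℕ n ℤ.- x /ℕ n
    distrib : ∀ x q n → ℤ.- (x ℤ.+ q ℤ.* n) ≡ ℤ.- x ℤ.+ (ℤ.- q) ℤ.* n
    distrib = solve-∀

table-ext : ∀ {m n} (u v : Subset2 m n) → (∀ p i → lookup (lookup u p) i ≡ lookup (lookup v p) i) → u ≡ v
table-ext u v same = Pointwise-≡⇒≡ (ext λ p → Pointwise-≡⇒≡ (ext (same p)))

-- Rotation by k moves column i - k of a table to column i, so every fact about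
-- rotations is a fact about the index map shiftIdx k.
module _ {n : ℕ} .{{_ : NonZero n}} where

  toℕ-shiftIdx : ∀ k (i : Fin n) → toℕ (shiftIdx k i) ≡ (+ toℕ i ℤ.- k) %ℕ n
  toℕ-shiftIdx k i = toℕ-fromℕ< (n%ℕd<d (+ toℕ i ℤ.- k) n)

  shiftIdx-cong : ∀ k k' → k ≡ k' mod n → ∀ i → shiftIdx k i ≡ shiftIdx k' i
  shiftIdx-cong k k' k≡k' i = toℕ-injective (begin
    toℕ (shiftIdx k i)         ≡⟨ toℕ-shiftIdx k i ⟩
    (+ toℕ i ℤ.- k) %ℕ n       ≡⟨ +-congʳ-mod n (ℤ.- k) (ℤ.- k') (+ toℕ i) (neg-cong-mod n k k' k≡k') ⟩
    (+ toℕ i ℤ.- k') %ℕ n      ≡⟨ sym (toℕ-shiftIdx k' i) ⟩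
    toℕ (shiftIdx k' i)        ∎)
    where open ≡-Reasoning

  shiftIdx-+ : ∀ k k' (i : Fin n) → shiftIdx k (shiftIdx k' i) ≡ shiftIdx (k ℤ.+ k') i
  shiftIdx-+ k k' i = toℕ-injective (begin
    toℕ (shiftIdx k (shiftIdx k' i))              ≡⟨ toℕ-shiftIdx k _ ⟩
    (+ toℕ (shiftIdx k' i) ℤ.- k) %ℕ n            ≡⟨ cong (λ r → (+ r ℤ.- k) %ℕ n) (toℕ-shiftIdx k' i) ⟩
    (+ ((+ toℕ i ℤ.- k') %ℕ n) ℤ.- k) %ℕ n        ≡⟨ drop-inner-residue ⟩
    ((+ toℕ i ℤ.- k') ℤ.- k) %ℕ n                 ≡⟨ cong (_%ℕ n) (sub-sub (+ toℕ i) k' k) ⟩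
    (+ toℕ i ℤ.- (k ℤ.+ k')) %ℕ n                 ≡⟨ sym (toℕ-shiftIdx (k ℤ.+ k') i) ⟩
    toℕ (shiftIdx (k ℤ.+ k') i)                   ∎)
    where
    open ≡-Reasoning
    drop-inner-residue : + ((+ toℕ i ℤ.- k') %ℕ n) ℤ.- k ≡ (+ toℕ i ℤ.- k') ℤ.- k mod n
    drop-inner-residue =
      +-congˡ-mod n (+ ((+ toℕ i ℤ.- k') %ℕ n)) (+ toℕ i ℤ.- k') (ℤ.- k) (residue-mod n (+ toℕ i ℤ.- k'))
    sub-sub : ∀ x a b → (x ℤ.- a) ℤ.- b ≡ x ℤ.- (b ℤ.+ a)
    sub-sub = solve-∀

  lookup-rot : ∀ {m} (u : Subset2 m n) k p i → lookup (lookup (rot u k) p) i ≡ lookup (lookup u p) (shiftIdx k i)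
  lookup-rot u k p i = trans (cong (λ row → lookup row i) (lookup-map p _ u)) (lookup∘tabulate _ i)

  rot-cong : ∀ {m} (u : Subset2 m n) k k' → k ≡ k' mod n → rot u k ≡ rot u k'
  rot-cong u k k' k≡k' = table-ext _ _ λ p i → begin
    lookup (lookup (rot u k) p) i          ≡⟨ lookup-rot u k p i ⟩
    lookup (lookup u p) (shiftIdx k i)     ≡⟨ cong (lookup (lookup u p)) (shiftIdx-cong k k' k≡k' i) ⟩
    lookup (lookup u p) (shiftIdx k' i)    ≡⟨ sym (lookup-rot u k' p i) ⟩
    lookup (lookup (rot u k') p) i         ∎
    where open ≡-Reasoning

  rot-+ : ∀ {m} (u : Subset2 m n) k k' → rot (rot u k) k' ≡ rot u (k ℤ.+ k')
  rot-+ u k k' = table-ext _ _ λ p i → begin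
    lookup (lookup (rot (rot u k) k') p) i           ≡⟨ lookup-rot (rot u k) k' p i ⟩
    lookup (lookup (rot u k) p) (shiftIdx k' i)      ≡⟨ lookup-rot u k p _ ⟩
    lookup (lookup u p) (shiftIdx k (shiftIdx k' i)) ≡⟨ cong (lookup (lookup u p)) (shiftIdx-+ k k' i) ⟩
    lookup (lookup u p) (shiftIdx (k ℤ.+ k') i)      ≡⟨ sym (lookup-rot u (k ℤ.+ k') p i) ⟩
    lookup (lookup (rot u (k ℤ.+ k')) p) i           ∎
    where open ≡-Reasoning

  rotWord-cong : ∀ {m} (t : List (Subset2 m n)) k k' → k ≡ k' mod n → rotWord t k ≡ rotWord t k'
  rotWord-cong t k k' k≡k' = LP.map-cong (λ u → rot-cong u k k' k≡k') t

  rotWord-+ : ∀ {m} (t : List (Subset2 m n)) k k' → rotWord (rotWord t k) k' ≡ rotWord t (k ℤ.+ k')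
  rotWord-+ t k k' = trans (sym (LP.map-∘ t)) (LP.map-cong (λ u → rot-+ u k k') t)

  symmetric-ℤ : ∀ {a b} (τ : Tree a b n) → Symmetric τ → ∀ t k → τ (rotWord t k) ≡ rot (τ t) k
  symmetric-ℤ τ sym-τ t k = begin
    τ (rotWord t k)        ≡⟨ cong τ (rotWord-cong t k (+ toℕ i) k≡i) ⟩
    τ (rotWord t (+ toℕ i)) ≡⟨ sym-τ t i ⟩
    rot (τ t) (+ toℕ i)    ≡⟨ rot-cong (τ t) (+ toℕ i) k (sym k≡i) ⟩
    rot (τ t) k            ∎
    where
    open ≡-Reasoning
    i : Fin n
    i = fromℕ< (n%ℕd<d k n)
    k≡i : k ≡ + toℕ i mod n
    k≡i = sym (trans (cong (λ r → + r %ℕ n) (toℕ-fromℕ< (n%ℕd<d k n))) (residue-mod n k))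

module SymmetricProduct {a b n : ℕ} .{{_ : NonZero n}} (M : Moore (Inp a n) (Vec Bool b)) where
  open Moore M

  run-component : ∀ t (s : Fin n → Fin k) j →
    run (prodδ M) s t j ≡ run δ (s j) (rotWord t (ℤ.- (+ toℕ j)))
  run-component []      s j = refl
  run-component (ι ∷ t) s j = run-component t (prodδ M s ι) j

  lookup-symProdTree : ∀ t p j →
    lookup (lookup (symProdTree M t) p) j ≡ lookup (L (run δ s₀ (rotWord t (ℤ.- (+ toℕ j))))) p
  lookup-symProdTree t p j = begin
    lookup (lookup (symProdTree M t) p) j                        ≡⟨ cong (λ row → lookup row j) (lookup∘tabulate _ p) ⟩
    lookup (tabulate (λ j → lookup (L (run (prodδ M) (prodS₀ M) t j)) p)) j ≡⟨ lookup∘tabulate _ j ⟩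
    lookup (L (run (prodδ M) (prodS₀ M) t j)) p                  ≡⟨ cong (λ s → lookup (L s) p) (run-component t (prodS₀ M) j) ⟩
    lookup (L (run δ s₀ (rotWord t (ℤ.- (+ toℕ j))))) p          ∎
    where open ≡-Reasoning

  -- Rotating the input by k makes process j read what process j - k read before.
  symProdTree-rot : ∀ t k → symProdTree M (rotWord t k) ≡ rot (symProdTree M t) k
  symProdTree-rot t k = table-ext _ _ λ p j → begin
    lookup (lookup (symProdTree M (rotWord t k)) p) j          ≡⟨ lookup-symProdTree (rotWord t k) p j ⟩
    output p (rotWord (rotWord t k) (ℤ.- (+ toℕ j)))           ≡⟨ cong (output p) (rotWord-+ t k (ℤ.- (+ toℕ j))) ⟩
    output p (rotWord t (k ℤ.- + toℕ j))                       ≡⟨ cong (output p) (same-process j) ⟩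
    output p (rotWord t (ℤ.- (+ toℕ (shiftIdx k j))))          ≡⟨ sym (lookup-symProdTree t p (shiftIdx k j)) ⟩
    lookup (lookup (symProdTree M t) p) (shiftIdx k j)         ≡⟨ sym (lookup-rot (symProdTree M t) k p j) ⟩
    lookup (lookup (rot (symProdTree M t) k) p) j              ∎
    where
    open ≡-Reasoning
    output : Fin b → List (Inp a n) → Bool
    output p w = lookup (L (run δ s₀ w)) p
    flip-difference : ∀ x y → ℤ.- (y ℤ.- x) ≡ x ℤ.- y
    flip-difference = solve-∀
    same-process : ∀ j → rotWord t (k ℤ.- + toℕ j) ≡ rotWord t (ℤ.- (+ toℕ (shiftIdx k j)))
    same-process j = rotWord-cong t (k ℤ.- + toℕ j) (ℤ.- (+ toℕ (shiftIdx k j))) (begin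
      (k ℤ.- + toℕ j) %ℕ n                  ≡⟨ cong (_%ℕ n) (flip-difference k (+ toℕ j)) ⟨
      (ℤ.- (+ toℕ j ℤ.- k)) %ℕ n            ≡⟨ neg-cong-mod n r (+ toℕ j ℤ.- k) (residue-mod n (+ toℕ j ℤ.- k)) ⟨
      (ℤ.- + ((+ toℕ j ℤ.- k) %ℕ n)) %ℕ n   ≡⟨ cong (λ r → (ℤ.- + r) %ℕ n) (toℕ-shiftIdx k j) ⟨
      (ℤ.- (+ toℕ (shiftIdx k j))) %ℕ n     ∎)
      where r = + ((+ toℕ j ℤ.- k) %ℕ n)

  symProd⇒symmetric : ∀ (τ : Tree a b n) → τ ≗T symProdTree M → Symmetric τ
  symProd⇒symmetric τ τ≗M t i = begin
    τ (rotWord t (+ toℕ i))               ≡⟨ τ≗M (rotWord t (+ toℕ i)) ⟩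
    symProdTree M (rotWord t (+ toℕ i))   ≡⟨ symProdTree-rot t (+ toℕ i) ⟩
    rot (symProdTree M t) (+ toℕ i)       ≡⟨ cong (λ u → rot u (+ toℕ i)) (τ≗M t) ⟨
    rot (τ t) (+ toℕ i)                   ∎
    where open ≡-Reasoning

Complete : {A : Set} → List A → Set
Complete xs = ∀ x → x ∈ xs

bools : List Bool
bools = true ∷ false ∷ []

bools-complete : Complete bools
bools-complete true  = here refl
bools-complete false = there (here refl)

vectors : ∀ {A : Set} → List A → (m : ℕ) → List (Vec A m)
vectors xs zero    = V.[] ∷ []
vectors xs (suc m) = cartesianProductWith V._∷_ xs (vectors xs m)

vectors-complete : ∀ {A : Set} {xs : List A} → Complete xs → ∀ m → Complete (vectors xs m)
vectors-complete xs-complete zero    V.[]       = here refl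
vectors-complete xs-complete (suc m) (x V.∷ v) =
  ∈-cartesianProductWith⁺ V._∷_ (xs-complete x) (vectors-complete xs-complete m v)

wordsUpTo : ∀ {A : Set} → List A → ℕ → List (List A)
wordsUpTo xs zero    = [] ∷ []
wordsUpTo xs (suc m) = [] ∷ cartesianProductWith _∷_ xs (wordsUpTo xs m)

wordsUpTo-complete : ∀ {A : Set} {xs : List A} → Complete xs →
  ∀ m (t : List A) → length t ≤ m → t ∈ wordsUpTo xs m
wordsUpTo-complete xs-complete zero    []      _           = here refl
wordsUpTo-complete xs-complete (suc m) []      _           = here refl
wordsUpTo-complete xs-complete (suc m) (x ∷ t) (ℕ.s≤s len) =
  there (∈-cartesianProductWith⁺ _∷_ (xs-complete x) (wordsUpTo-complete xs-complete m t len))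

inputs-complete : ∀ a n → Complete (vectors (vectors bools n) a)
inputs-complete a n = vectors-complete (vectors-complete bools-complete n) a

length-cut : ∀ {A : Set} (t : List A) {i j} → i < j → j ≤ length t → length (take i t ++ drop j t) < length t
length-cut t {i} {j} i<j j≤ = begin-strict
  length (take i t ++ drop j t)                 ≡⟨ LP.length-++ (take i t) ⟩
  length (take i t) ℕ.+ length (drop j t)       ≡⟨ cong₂ ℕ._+_ (LP.length-take i t) (LP.length-drop j t) ⟩
  (i ⊓ length t) ℕ.+ (length t ∸ j)             ≤⟨ ℕP.+-monoˡ-≤ (length t ∸ j) (ℕP.m⊓n≤m i (length t)) ⟩
  i ℕ.+ (length t ∸ j)                          <⟨ ℕP.+-monoˡ-< (length t ∸ j) i<j ⟩
  j ℕ.+ (length t ∸ j)                          ≡⟨ ℕP.m+[n∸m]≡n j≤ ⟩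
  length t                                      ∎
  where open ℕP.≤-Reasoning

record FiniteCongruence {a b n : ℕ} (τ : Tree a b n) : Set where
  field
    N       : ℕ
    class   : List (Inp a n) → Fin N
    right   : ∀ t t' w → class t ≡ class t' → class (t ++ w) ≡ class (t' ++ w)
    factors : ∀ t t' → class t ≡ class t' → τ t ≡ τ t'

module _ {a b n : ℕ} {τ : Tree a b n} (C : FiniteCongruence τ) where
  open FiniteCongruence C

  class-cut : ∀ t i j → class (take i t) ≡ class (take j t) → class (take i t ++ drop j t) ≡ class t
  class-cut t i j same = trans (right (take i t) (take j t) (drop j t) same)
                               (cong class (LP.take++drop≡id j t))

  short-representative : ∀ m t → length t ≤ m → ∃ λ t' → length t' ≤ N × class t' ≡ class t
  short-representative m t _ with length t ≤? N
  ... | yes short = t , short , refl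
  short-representative zero    []      _   | no _ = [] , ℕ.z≤n , refl
  short-representative (suc m) t       len | no long
    with pigeonhole (ℕP.m<n⇒m<1+n (ℕP.≰⇒> long)) (λ i → class (take (toℕ i) t))
  ... | i , j , i<j , same =
    let cut = take (toℕ i) t ++ drop (toℕ j) t
        shorter = length-cut t i<j (ℕP.≤-pred (toℕ<n j))
        (t' , t'-short , t'≡cut) = short-representative m cut (ℕP.≤-pred (ℕP.≤-trans shorter len))
    in t' , t'-short , trans t'≡cut (class-cut t (toℕ i) (toℕ j) same)

  finiteCongruence⇒regular : Regular τ
  finiteCongruence⇒regular = wordsUpTo (vectors (vectors bools n) a) N , λ t →
    let (t' , t'-short , t'≡t) = short-representative (length t) t ℕP.≤-refl
    in t' , wordsUpTo-complete (inputs-complete a n) N t' t'-short ,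
       λ s → factors (t ++ s) (t' ++ s) (right t t' s (sym t'≡t))

induced : ∀ {I O : Set} → Moore I O → List I → O
induced M t = Moore.L M (run (Moore.δ M) (Moore.s₀ M) t)

module Nerode {a b n : ℕ} (τ : Tree a b n) (reg : Regular τ) where
  reps : List (List (Inp a n))
  reps = proj₁ reg

  K : ℕ
  K = length reps

  rep : Fin K → List (Inp a n)
  rep = List.lookup reps

  classOf : List (Inp a n) → Fin K
  classOf t = let (_ , r∈reps , _) = proj₂ reg t in Any.index r∈reps

  classOf-sound : ∀ t → subtree τ t ≗T subtree τ (rep (classOf t))
  classOf-sound t s = let (r , r∈reps , t∼r) = proj₂ reg t in
    trans (t∼r s) (cong (λ r' → τ (r' ++ s)) (lookup-index r∈reps))

  machine : Moore (Inp a n) (Out b n)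
  machine = record
    { k  = K
    ; δ  = λ i ι → classOf (rep i ++ ι ∷ [])
    ; s₀ = classOf []
    ; L  = λ i → τ (rep i)
    }
  open Moore machine using (δ)

  invariant : ∀ w u i → subtree τ u ≗T subtree τ (rep i) →
              subtree τ (u ++ w) ≗T subtree τ (rep (run δ i w))
  invariant []      u i u∼i s = trans (cong (λ v → τ (v ++ s)) (LP.++-identityʳ u)) (u∼i s)
  invariant (ι ∷ w) u i u∼i s =
    trans (cong (λ v → τ (v ++ s)) (sym (LP.++-assoc u (ι ∷ []) w)))
          (invariant w (u ++ ι ∷ []) (δ i ι) step s)
    where
    step : subtree τ (u ++ ι ∷ []) ≗T subtree τ (rep (δ i ι))
    step s' = begin
      τ ((u ++ ι ∷ []) ++ s')         ≡⟨ cong τ (LP.++-assoc u (ι ∷ []) s') ⟩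
      τ (u ++ ι ∷ s')                 ≡⟨ u∼i (ι ∷ s') ⟩
      τ (rep i ++ ι ∷ s')             ≡⟨ cong τ (LP.++-assoc (rep i) (ι ∷ []) s') ⟨
      τ ((rep i ++ ι ∷ []) ++ s')     ≡⟨ classOf-sound (rep i ++ ι ∷ []) s' ⟩
      τ (rep (δ i ι) ++ s')           ∎
      where open ≡-Reasoning

  correct : τ ≗T induced machine
  correct w = begin
    τ w                                   ≡⟨ cong τ (LP.++-identityʳ w) ⟨
    τ (w ++ [])                           ≡⟨ invariant w [] (classOf []) (classOf-sound []) [] ⟩
    τ (rep (run δ (classOf []) w) ++ [])  ≡⟨ cong τ (LP.++-identityʳ _) ⟩
    induced machine w                     ∎
    where open ≡-Reasoning

fin0 : ∀ {n} .{{_ : NonZero n}} → Fin n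
fin0 {suc n} = F.zero

toℕ-fin0 : ∀ {n} .{{_ : NonZero n}} → toℕ (fin0 {n}) ≡ 0
toℕ-fin0 {suc n} = refl

module _ {n : ℕ} .{{_ : NonZero n}} where

  shiftIdx-neg-fin0 : ∀ (j : Fin n) → shiftIdx (ℤ.- (+ toℕ j)) fin0 ≡ j
  shiftIdx-neg-fin0 j = toℕ-injective (begin
    toℕ (shiftIdx (ℤ.- (+ toℕ j)) fin0)          ≡⟨ toℕ-shiftIdx (ℤ.- (+ toℕ j)) fin0 ⟩
    (+ toℕ (fin0 {n}) ℤ.- ℤ.- (+ toℕ j)) %ℕ n    ≡⟨ cong (λ z → (+ z ℤ.- ℤ.- (+ toℕ j)) %ℕ n) (toℕ-fin0 {n}) ⟩
    (+ 0 ℤ.- ℤ.- (+ toℕ j)) %ℕ n                 ≡⟨ cong (_%ℕ n) (ℤP.+-identityˡ (ℤ.- ℤ.- (+ toℕ j))) ⟩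
    (ℤ.- ℤ.- (+ toℕ j)) %ℕ n                     ≡⟨ cong (_%ℕ n) (ℤP.neg-involutive (+ toℕ j)) ⟩
    (+ toℕ j) %ℕ n                               ≡⟨ m<n⇒m%n≡m (toℕ<n j) ⟩
    toℕ j                                        ∎)
    where open ≡-Reasoning

  process0 : ∀ {a b} → Moore (Inp a n) (Out b n) → Moore (Inp a n) (Vec Bool b)
  process0 M = record
    { k  = Moore.k M
    ; δ  = Moore.δ M
    ; s₀ = Moore.s₀ M
    ; L  = λ s → tabulate (λ p → lookup (lookup (Moore.L M s) p) fin0)
    }

  -- A symmetric tree induced by M is the symmetric product of process0 M:
  -- output (p , j) on t is output (p , 0) on t rotated by -j.
  symmetric⇒symProd : ∀ {a b} (τ : Tree a b n) (M : Moore (Inp a n) (Out b n)) →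
    Symmetric τ → τ ≗T induced M → τ ≗T symProdTree (process0 M)
  symmetric⇒symProd {b = b} τ M sym-τ τ≗M t = table-ext _ _ entry
    where
    open ≡-Reasoning
    entry : ∀ p j → lookup (lookup (τ t) p) j ≡ lookup (lookup (symProdTree (process0 M) t) p) j
    entry p j = begin
      lookup (lookup (τ t) p) j                     ≡⟨ cong (lookup (lookup (τ t) p)) (shiftIdx-neg-fin0 j) ⟨
      lookup (lookup (τ t) p) (shiftIdx back fin0)  ≡⟨ lookup-rot (τ t) back p fin0 ⟨
      entry₀ (rot (τ t) back)                       ≡⟨ cong entry₀ (symmetric-ℤ τ sym-τ t back) ⟨
      entry₀ (τ (rotWord t back))                   ≡⟨ cong entry₀ (τ≗M (rotWord t back)) ⟩
      entry₀ (induced M (rotWord t back))           ≡⟨ lookup∘tabulate _ p ⟨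
      lookup (Moore.L (process0 M) (run (Moore.δ M) (Moore.s₀ M) (rotWord t back))) p
        ≡⟨ SymmetricProduct.lookup-symProdTree (process0 M) t p j ⟨
      lookup (lookup (symProdTree (process0 M) t) p) j ∎
      where
      back : ℤ
      back = ℤ.- (+ toℕ j)
      entry₀ : Out b n → Bool
      entry₀ u = lookup (lookup u p) fin0

run-++ : ∀ {S I : Set} (δ : S → I → S) s u w → run δ s (u ++ w) ≡ run δ (run δ s u) w
run-++ δ s []      w = refl
run-++ δ s (ι ∷ u) w = run-++ δ (δ s ι) u w

-- funToFin encodes functions Fin m → Fin k as numbers below k ^ m, faithfully
-- up to pointwise equality.
funToFin-cong : ∀ {m k} {f g : Fin m → Fin k} → (∀ i → f i ≡ g i) → funToFin f ≡ funToFin g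
funToFin-cong {zero}  _   = refl
funToFin-cong {suc m} f≗g = cong₂ combine (f≗g F.zero) (funToFin-cong (λ i → f≗g (F.suc i)))

funToFin-injective : ∀ {m k} (f g : Fin m → Fin k) → funToFin f ≡ funToFin g → ∀ i → f i ≡ g i
funToFin-injective f g same i =
  trans (sym (finToFun-funToFin f i)) (trans (cong (λ x → finToFun x i) same) (finToFun-funToFin g i))

module ProductRegular {a b n : ℕ} .{{_ : NonZero n}} (M : Moore (Inp a n) (Vec Bool b)) where
  open Moore M

  state : List (Inp a n) → Fin n → Fin k
  state = run (prodδ M) (prodS₀ M)

  run-cong : ∀ {s s'} w → (∀ j → s j ≡ s' j) → ∀ j → run (prodδ M) s w j ≡ run (prodδ M) s' w j
  run-cong []      s≗s' = s≗s'
  run-cong (ι ∷ w) s≗s' = run-cong w (λ j → cong (λ x → δ x (rot ι (ℤ.- (+ toℕ j)))) (s≗s' j))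

  prodL-cong : ∀ {s s'} → (∀ j → s j ≡ s' j) → prodL M s ≡ prodL M s'
  prodL-cong s≗s' = tabulate-cong (λ p → tabulate-cong (λ j → cong (λ x → lookup (L x) p) (s≗s' j)))

  productCongruence : (τ : Tree a b n) → τ ≗T symProdTree M → FiniteCongruence τ
  productCongruence τ τ≗M = record
    { N       = k ^ n
    ; class   = λ t → funToFin (state t)
    ; right   = λ t t' w same → funToFin-cong (extend t t' w (funToFin-injective _ _ same))
    ; factors = λ t t' same →
        trans (τ≗M t) (trans (prodL-cong (funToFin-injective _ _ same)) (sym (τ≗M t')))
    }
    where
    extend : ∀ t t' w → (∀ j → state t j ≡ state t' j) → ∀ j → state (t ++ w) j ≡ state (t' ++ w) j
    extend t t' w t≗t' j = begin
      state (t ++ w) j                 ≡⟨ cong (λ s → s j) (run-++ (prodδ M) (prodS₀ M) t w) ⟩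
      run (prodδ M) (state t) w j      ≡⟨ run-cong w t≗t' j ⟩
      run (prodδ M) (state t') w j     ≡⟨ cong (λ s → s j) (run-++ (prodδ M) (prodS₀ M) t' w) ⟨
      state (t' ++ w) j                ∎
      where open ≡-Reasoning

lemma5 : (a b n : ℕ) .{{_ : NonZero n}} (τ : Tree a b n) →
    (Regular τ × Symmetric τ) ⇔
      Σ (Moore (Inp a n) (Vec Bool b)) (λ M → τ ≗T symProdTree M)
lemma5 a b n τ = mk⇔ to from
  where
  to : Regular τ × Symmetric τ → Σ (Moore (Inp a n) (Vec Bool b)) (λ M → τ ≗T symProdTree M)
  to (reg , sym-τ) = process0 machine , symmetric⇒symProd τ machine sym-τ correct
    where open Nerode τ reg
  from : Σ (Moore (Inp a n) (Vec Bool b)) (λ M → τ ≗T symProdTree M) → Regular τ × Symmetric τ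
  from (M , τ≗M) = finiteCongruence⇒regular (ProductRegular.productCongruence M τ τ≗M)
                 , SymmetricProduct.symProd⇒symmetric M τ τ≗M
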